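{- $$F_{\{132,231\}}(x,q,z)=F_{\{213,231\}}(x,q,z)=\frac{1-z-qz^2+xqz^3}{(1-xz)(1-z-2qz^2)}.$$
   Context: For permutations $\pi=\pi_1\cdots\pi_n\in\mathfrak{S}_n$ and $\sigma\in\mathfrak{S}_m$, $\pi$ contains $\sigma$ if there are indices $i_1<\dots<i_m$ such that $\pi_{i_1}\cdots\pi_{i_m}$ is in the same relative order as $\sigma$; otherwise $\pi$ avoids $\sigma$. For a set $\Sigma$ of patterns, $\mathfrak{S}_n(\Sigma)$ is the set of permutations in $\mathfrak{S}_n$ avoiding every pattern in $\Sigma$. $\mathrm{fp}(\pi)=|\{i:\pi_i=i\}|$, $\mathrm{exc}(\pi)=|\{i:\pi_i>i\}|$, and $F_\Sigma(x,q,z)=\sum_{n\ge0}\sum_{\pi\in\mathfrak{S}_n(\Sigma)}x^{\mathrm{fp}(\pi)}q^{\mathrm{exc}(\pi)}z^n$. -}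

module Defs where

open import Data.Nat as ℕ using (ℕ; zero; suc; _∸_)
open import Data.Fin as Fin using (Fin; toℕ; _≟_; _<?_)
open import Data.Vec using (Vec; lookup; []; _∷_)
open import Data.List using (List; length; filter; []; _∷_)
open import Data.List.Membership.Propositional using (_∈_)
open import Data.Fin.Base using () renaming (_<_ to _<ᶠ_)
open import Data.List.Base using () renaming (allFin to allFinL)
open import Data.Integer as ℤ using (ℤ; +_; -_)
open import Data.Product using (Σ; _×_; _,_)
open import Data.Refinement using (Refinement)
open import Function.Bundles using (_⇔_; _↔_)
open import Relation.Nullary using (¬_)
open import Relation.Binary.PropositionalEquality using (_≡_)
open import Relation.Nullary.Decidable using (⌊_⌋)
open import Data.Bool using (if_then_else_; _∧_)

-- A permutation π ∈ 𝔖_n is a word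
-- π₁⋯πₙ, represented as a vector of length n with entries in Fin n
-- (0-based: entry k stands for the value k+1), with distinct entries.

IsPerm : {n : ℕ} → Vec (Fin n) n → Set
IsPerm {n} π = (i j : Fin n) → lookup π i ≡ lookup π j → i ≡ j

Pattern : Set
Pattern = Σ ℕ (λ m → Vec ℕ m)

Contains : {n : ℕ} → Vec (Fin n) n → Pattern → Set
Contains {n} π (m , σ) =
  Σ (Fin m → Fin n) λ e →
    ((a b : Fin m) → a <ᶠ b → e a <ᶠ e b) ×
    ((a b : Fin m) → (lookup π (e a) <ᶠ lookup π (e b)) ⇔ (lookup σ a ℕ.< lookup σ b))

Avoids : {n : ℕ} → Vec (Fin n) n → List Pattern → Set
Avoids π ps = (σ : Pattern) → σ ∈ ps → ¬ Contains π σ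

fp : {n : ℕ} → Vec (Fin n) n → ℕ
fp {n} π = length (filter (λ i → lookup π i ≟ i) (allFinL n))

exc : {n : ℕ} → Vec (Fin n) n → ℕ
exc {n} π = length (filter (λ i → i <? lookup π i) (allFinL n))

-- The set {π ∈ 𝔖_n(Σ) : fp π = i, exc π = j} (proofs irrelevant, so
-- elements are determined by the word π).
AvoidSet : List Pattern → ℕ → ℕ → ℕ → Set
AvoidSet ps n i j =
  Refinement (Vec (Fin n) n) (λ π → IsPerm π × Avoids π ps × fp π ≡ i × exc π ≡ j)

IsCount : List Pattern → (ℕ → ℕ → ℕ → ℕ) → Set
IsCount ps c = (n i j : ℕ) → Fin (c n i j) ↔ AvoidSet ps n i j

-- Formal power series in x, q, z with integer coefficients:
-- s n i j = coefficient of z^n x^i q^j.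

PS : Set
PS = ℕ → ℕ → ℕ → ℤ

∑≤ : ℕ → (ℕ → ℤ) → ℤ
∑≤ zero f = f zero
∑≤ (suc n) f = ∑≤ n f ℤ.+ f (suc n)

_⊛_ : PS → PS → PS
(f ⊛ g) n i j =
  ∑≤ n λ n₁ → ∑≤ i λ i₁ → ∑≤ j λ j₁ →
    f n₁ i₁ j₁ ℤ.* g (n ∸ n₁) (i ∸ i₁) (j ∸ j₁)

_⊕_ : PS → PS → PS
(f ⊕ g) n i j = f n i j ℤ.+ g n i j

infixl 6 _⊕_
infixl 7 _⊛_

mono : ℤ → ℕ → ℕ → ℕ → PS
mono c a b d n i j =
  if ⌊ n ℕ.≟ a ⌋ ∧ ⌊ i ℕ.≟ b ⌋ ∧ ⌊ j ℕ.≟ d ⌋ then c else + 0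

genF : (ℕ → ℕ → ℕ → ℕ) → PS
genF c n i j = + c n i j

numer : PS
numer = mono (+ 1) 0 0 0 ⊕ mono (- + 1) 1 0 0 ⊕ mono (- + 1) 2 0 1 ⊕ mono (+ 1) 3 1 1

den₁ : PS
den₁ = mono (+ 1) 0 0 0 ⊕ mono (- + 1) 1 1 0

den₂ : PS
den₂ = mono (+ 1) 0 0 0 ⊕ mono (- + 1) 1 0 0 ⊕ mono (- + 2) 2 0 1

-- F = numer / (den₁ den₂) as formal power series (den₁ den₂ has constant
-- term 1, hence is invertible; F = N/D  ⟺  F · D = N).
HasGF : (ℕ → ℕ → ℕ → ℕ) → Set
HasGF c = (n i j : ℕ) → (genF c ⊛ (den₁ ⊛ den₂)) n i j ≡ numer n i j

p132 p231 p213 : Pattern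
p132 = 3 , (1 ∷ 3 ∷ 2 ∷ [])
p231 = 3 , (2 ∷ 3 ∷ 1 ∷ [])
p213 = 3 , (2 ∷ 1 ∷ 3 ∷ [])

-- Both classes are coded by binary words.  A {132, 231}-avoider of size n + 1 arises from one
-- of size n by putting a new maximum first or last, and a {213, 231}-avoider by putting a new
-- maximum or a new minimum first; the word records the choices.
-- In both codings an entry is a fixed point or an excedance according to a rule depending only on
-- the word, so both classes have the same refined count.  Splitting on the first letter gives
-- F (n+1) = x F n + q H n, where z q H counts the avoiders beginning with their maximum, and
-- H (n+3) = H (n+2) + 2 q H (n+1).  Hence (1 - x z) F = 1 + z q H and
-- (1 - z - 2 q z²) (1 + z q H) = 1 - z - q z² + x q z³, the second identity by comparing
-- coefficients.  Multiplying a series by a polynomial only shifts and scales its coefficients;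
-- this computes the products with the two denominator factors and also gives the associativity
-- needed to multiply by them one at a time.
module Submission where

open import Defs
open import Data.Nat as ℕ using (ℕ; zero; suc; _+_; _∸_; z≤n; s≤s; z<s; _≡ᵇ_; _<ᵇ_)
import Data.Nat.Properties as ℕ
open import Data.Integer as ℤ using (ℤ; +_; -_)
import Data.Integer.Properties as ℤ
open import Data.Integer.Tactic.RingSolver using (solve-∀)
open import Data.Bool using (Bool; true; false; T; if_then_else_; _∧_)
open import Data.Fin as Fin
  using (Fin; zero; suc; toℕ; fromℕ; inject₁; punchIn; punchOut; pinch; _<_; _≟_; _<?_)
import Data.Fin.Properties as Fin
open import Data.Fin.Patterns using (0F; 1F; 2F)
open import Data.Fin.Permutation using (↔⇒≡)
open import Data.Vec using (Vec; lookup; tabulate; []; _∷_)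
open import Data.Vec.Properties using (lookup∘tabulate; tabulate∘lookup; tabulate-cong; ≡-dec)
open import Data.Vec.Functional using (insertAt; removeAt)
open import Data.Vec.Functional.Properties using (insertAt-lookup; insertAt-punchIn; removeAt-insertAt)
import Data.List as List
open import Data.List using (List; []; _∷_)
open import Data.List.Membership.Propositional using (_∈_)
open import Data.List.Relation.Unary.Any using (here; there)
open import Data.List.Relation.Unary.All as All using (All; []; _∷_)
open import Data.Product using (Σ; _×_; _,_; proj₁; proj₂; ∃)
open import Data.Sum using (_⊎_; inj₁; inj₂)
open import Data.Sum.Function.Propositional using (_⊎-↔_)
open import Data.Empty using (⊥; ⊥-elim)
import Data.Empty.Irrelevant as Irrelevant
open import Data.Irrelevant using ([_])
open import Data.Refinement using (_,_; value-injective)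
open import Algebra.Properties.CommutativeMonoid.Sum ℕ.+-0-commutativeMonoid
  using (sum; sum-remove; sum-cong-≗)
open import Algebra.Properties.CommutativeSemigroup ℕ.+-commutativeSemigroup
  using () renaming (interchange to ℕ-interchange)
open import Algebra.Properties.CommutativeSemigroup ℤ.+-commutativeSemigroup
  using () renaming (interchange to ℤ-interchange)
open import Function using (_∘_; _⇔_; mk⇔; Equivalence; Injective; _↔_; mk↔ₛ′)
open import Function.Properties.Inverse using (↔-trans; ↔-sym)
open import Relation.Nullary using (¬_; yes; no; does; contradiction)
open import Relation.Nullary.Decidable using (True; toWitness; _→-dec_; recompute; isYes≗does)
open import Relation.Unary using (Decidable)
open import Relation.Binary using (Tri; tri<; tri≈; tri>)
open import Relation.Binary.PropositionalEquality

private
  variable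
    m n M K K′ : ℕ

StrictlyIncreasing : (Fin m → Fin M) → Set
StrictlyIncreasing {m} e = (a b : Fin m) → a < b → e a < e b

-- `Contains π σ` unfolds to `Containsᶠ (lookup π) σ`, and likewise for `Avoids`.
Containsᶠ : (Fin M → Fin K) → Pattern → Set
Containsᶠ {M} g (m , σ) =
  Σ (Fin m → Fin M) λ e →
    StrictlyIncreasing e × ((a b : Fin m) → (g (e a) < g (e b)) ⇔ (lookup σ a ℕ.< lookup σ b))

Avoidsᶠ : (Fin M → Fin K) → List Pattern → Set
Avoidsᶠ g ps = (σ : Pattern) → σ ∈ ps → ¬ Containsᶠ g σ

SameOrder : (Fin M → Fin K) → (Fin M → Fin K′) → Set
SameOrder {M} g g′ = (a b : Fin M) → (g a < g b) ⇔ (g′ a < g′ b)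

OrderEmbedding : (Fin K → Fin K′) → Set
OrderEmbedding φ = SameOrder (λ x → x) φ

containsᶠ-sameOrder : {g : Fin M → Fin K} {g′ : Fin M → Fin K′} {σ : Pattern} →
  SameOrder g g′ → Containsᶠ g σ → Containsᶠ g′ σ
containsᶠ-sameOrder same (e , increasing , order) =
  e , increasing , λ a b → mk⇔ (to (order a b) ∘ from (same (e a) (e b)))
                               (to (same (e a) (e b)) ∘ from (order a b))
  where open Equivalence

sameOrder-≗ : {g g′ : Fin M → Fin K} → (∀ a → g a ≡ g′ a) → SameOrder g g′
sameOrder-≗ g≗g′ a b =
  mk⇔ (subst₂ _<_ (g≗g′ a) (g≗g′ b)) (subst₂ _<_ (sym (g≗g′ a)) (sym (g≗g′ b)))

sameOrder-embedding : {φ : Fin K → Fin K′} → OrderEmbedding φ → (g : Fin M → Fin K) → SameOrder g (φ ∘ g)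
sameOrder-embedding φ-embedding g a b = φ-embedding (g a) (g b)

sameOrder-sym : {g : Fin M → Fin K} {g′ : Fin M → Fin K′} → SameOrder g g′ → SameOrder g′ g
sameOrder-sym same a b = mk⇔ (Equivalence.from (same a b)) (Equivalence.to (same a b))

inject₁-embedding : OrderEmbedding (inject₁ {n})
inject₁-embedding x y =
  mk⇔ (subst₂ ℕ._<_ (sym (Fin.toℕ-inject₁ x)) (sym (Fin.toℕ-inject₁ y)))
      (subst₂ ℕ._<_ (Fin.toℕ-inject₁ x) (Fin.toℕ-inject₁ y))

suc-embedding : OrderEmbedding (suc {n})
suc-embedding x y = mk⇔ s≤s ℕ.s≤s⁻¹

avoidsᶠ-≗ : {g g′ : Fin M → Fin K} {ps : List Pattern} →
  (∀ k → g k ≡ g′ k) → Avoidsᶠ g ps → Avoidsᶠ g′ ps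
avoidsᶠ-≗ g≗g′ g-avoids σ σ∈ps =
  g-avoids σ σ∈ps ∘ containsᶠ-sameOrder {σ = σ} (sameOrder-≗ (sym ∘ g≗g′))

containsᶠ-∘ : {g : Fin M → Fin K} {h : Fin m → Fin M} {σ : Pattern} →
  StrictlyIncreasing h → Containsᶠ (g ∘ h) σ → Containsᶠ g σ
containsᶠ-∘ {h = h} h-increasing (e , increasing , order) =
  h ∘ e , (λ a b → h-increasing (e a) (e b) ∘ increasing a b) , order

punchIn-increasing : ∀ (i : Fin (suc n)) → StrictlyIncreasing (punchIn i)
punchIn-increasing zero    a       b       a<b       = s≤s a<b
punchIn-increasing (suc i) zero    (suc b) _         = z<s
punchIn-increasing (suc i) (suc a) (suc b) (s≤s a<b) = s≤s (punchIn-increasing i a b a<b)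

punchIn-cancel-< : ∀ (i : Fin (suc n)) {a b} → punchIn i a < punchIn i b → a < b
punchIn-cancel-< zero    {a}     {b}     (s≤s a<b) = a<b
punchIn-cancel-< (suc i) {zero}  {suc b} _         = z<s
punchIn-cancel-< (suc i) {suc a} {suc b} (s≤s a<b) = s≤s (punchIn-cancel-< i a<b)

containsᶠ-removeAt : {g : Fin (suc M) → Fin K} {i : Fin (suc M)} {σ : Pattern} →
  ((e , _) : Containsᶠ g σ) → (∀ a → e a ≢ i) → Containsᶠ (removeAt g i) σ
containsᶠ-removeAt {M = M} {g = g} {i} {σ} (e , increasing , order) misses =
  e′ , (λ a b → punchIn-cancel-< i ∘ subst₂ _<_ (e≡ a) (e≡ b) ∘ increasing a b) ,
  λ a b → subst₂ (λ x y → (g x < g y) ⇔ _) (e≡ a) (e≡ b) (order a b)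
  where
  e′ : Fin (proj₁ σ) → Fin M
  e′ a = punchOut (misses a ∘ sym)
  e≡ : ∀ a → e a ≡ punchIn i (e′ a)
  e≡ a = sym (Fin.punchIn-punchOut (misses a ∘ sym))

singleton-avoids : {g : Fin 1 → Fin K} {ps : List Pattern} → All (λ σ → 1 ℕ.< proj₁ σ) ps → Avoidsᶠ g ps
singleton-avoids long σ σ∈ps (e , increasing , _) with All.lookup long σ∈ps
... | s≤s (s≤s _) with e 0F | e 1F | increasing 0F 1F z<s
...   | zero | zero | ()

-- A pattern occurring in an empty function is empty, so it occurs in every function.
empty-avoids : {g : Fin M → Fin K} {h : Fin 0 → Fin K′} {ps : List Pattern} → Avoidsᶠ g ps → Avoidsᶠ h ps
empty-avoids g-avoids (zero  , σ) σ∈ps _           = g-avoids _ σ∈ps ((λ ()) , (λ ()) , λ ())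
empty-avoids g-avoids (suc _ , σ) σ∈ps (e , _ , _) = Fin.¬Fin0 (e zero)

containsᶠ-intro : {g : Fin M → Fin K} {σ : Vec ℕ m} (e : Fin m → Fin M) → StrictlyIncreasing e →
  Injective _≡_ _≡_ (lookup σ) → (∀ a b → T (lookup σ a <ᵇ lookup σ b) → g (e a) < g (e b)) →
  Containsᶠ g (m , σ)
containsᶠ-intro {g = g} {σ} e increasing σ-injective values =
  e , increasing , λ a b → mk⇔ (reflect a b) (values a b ∘ ℕ.<⇒<ᵇ)
  where
  reflect : ∀ a b → g (e a) < g (e b) → lookup σ a ℕ.< lookup σ b
  reflect a b ga<gb with ℕ.<-cmp (lookup σ a) (lookup σ b)
  ... | tri< σa<σb _ _ = σa<σb
  ... | tri≈ _ σa≡σb _ =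
    contradiction (subst (λ c → g (e c) < g (e b)) (σ-injective σa≡σb) ga<gb) (Fin.<-irrefl refl)
  ... | tri> _ _ σb<σa = contradiction (values b a (ℕ.<⇒<ᵇ σb<σa)) (Fin.<-asym ga<gb)

lookup-injective : (σ : Vec ℕ m) →
  {True (Fin.all? λ a → Fin.all? λ b → (lookup σ a ℕ.≟ lookup σ b) →-dec (a ≟ b))} →
  Injective _≡_ _≡_ (lookup σ)
lookup-injective σ {distinct} {a} {b} = toWitness distinct a b

module _ {g : Fin M → Fin K} {p₀ p₁ p₂ : Fin M} (p₀<p₁ : p₀ < p₁) (p₁<p₂ : p₁ < p₂) where

  private
    p : Fin 3 → Fin M
    p = lookup (p₀ ∷ p₁ ∷ p₂ ∷ [])

    p-increasing : StrictlyIncreasing p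
    p-increasing a b = increasing a b ∘ ℕ.<⇒<ᵇ
      where
      increasing : ∀ a b → T (toℕ a <ᵇ toℕ b) → p a < p b
      increasing 0F 1F _ = p₀<p₁
      increasing 0F 2F _ = Fin.<-trans p₀<p₁ p₁<p₂
      increasing 1F 2F _ = p₁<p₂
      increasing 0F 0F ()
      increasing 1F 0F ()
      increasing 1F 1F ()
      increasing 2F 0F ()
      increasing 2F 1F ()
      increasing 2F 2F ()

  contains-213 : g p₁ < g p₀ → g p₀ < g p₂ → Containsᶠ g p213
  contains-213 g₁<g₀ g₀<g₂ =
    containsᶠ-intro {g = g} {σ = proj₂ p213} p p-increasing (lookup-injective (proj₂ p213)) values
    where
    values : ∀ a b → T (lookup (proj₂ p213) a <ᵇ lookup (proj₂ p213) b) → g (p a) < g (p b)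
    values 0F 2F _ = g₀<g₂
    values 1F 0F _ = g₁<g₀
    values 1F 2F _ = Fin.<-trans g₁<g₀ g₀<g₂
    values 0F 0F ()
    values 0F 1F ()
    values 1F 1F ()
    values 2F 0F ()
    values 2F 1F ()
    values 2F 2F ()

  contains-231 : g p₂ < g p₀ → g p₀ < g p₁ → Containsᶠ g p231
  contains-231 g₂<g₀ g₀<g₁ =
    containsᶠ-intro {g = g} {σ = proj₂ p231} p p-increasing (lookup-injective (proj₂ p231)) values
    where
    values : ∀ a b → T (lookup (proj₂ p231) a <ᵇ lookup (proj₂ p231) b) → g (p a) < g (p b)
    values 0F 1F _ = g₀<g₁
    values 2F 0F _ = g₂<g₀
    values 2F 1F _ = Fin.<-trans g₂<g₀ g₀<g₁
    values 0F 0F ()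
    values 0F 2F ()
    values 1F 0F ()
    values 1F 1F ()
    values 1F 2F ()
    values 2F 2F ()

  contains-132 : g p₀ < g p₂ → g p₂ < g p₁ → Containsᶠ g p132
  contains-132 g₀<g₂ g₂<g₁ =
    containsᶠ-intro {g = g} {σ = proj₂ p132} p p-increasing (lookup-injective (proj₂ p132)) values
    where
    values : ∀ a b → T (lookup (proj₂ p132) a <ᵇ lookup (proj₂ p132) b) → g (p a) < g (p b)
    values 0F 1F _ = Fin.<-trans g₀<g₂ g₂<g₁
    values 0F 2F _ = g₀<g₂
    values 2F 1F _ = g₂<g₁
    values 0F 0F ()
    values 1F 0F ()
    values 1F 1F ()
    values 1F 2F ()
    values 2F 0F ()
    values 2F 2F ()

maxFirst : (Fin n → Fin K) → Fin (suc n) → Fin (suc K)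
maxFirst {K = K} f = insertAt (inject₁ ∘ f) zero (fromℕ K)

minFirst : (Fin n → Fin K) → Fin (suc n) → Fin (suc K)
minFirst f = insertAt (suc ∘ f) zero zero

maxLast : (Fin n → Fin K) → Fin (suc n) → Fin (suc K)
maxLast {n} {K} f = insertAt (inject₁ ∘ f) (fromℕ n) (fromℕ K)

data PunchedView (i : Fin (suc n)) : Fin (suc n) → Set where
  at-i    : PunchedView i i
  punched : (k : Fin n) → PunchedView i (punchIn i k)

punchedView : (i k : Fin (suc n)) → PunchedView i k
punchedView i k with i ≟ k
... | yes refl = at-i
... | no  i≢k  = subst (PunchedView i) (Fin.punchIn-punchOut i≢k) (punched (punchOut i≢k))

module _ {A : Set} where

  insertAt-≗ : {f : Fin n → A} {g : Fin (suc n) → A} {i : Fin (suc n)} {v : A} →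
    (∀ k → f k ≡ removeAt g i k) → v ≡ g i → ∀ k → insertAt f i v k ≡ g k
  insertAt-≗ {f = f} {i = i} {v} f≗ v≡ k with punchedView i k
  ... | at-i       = trans (insertAt-lookup f i v) v≡
  ... | punched k′ = trans (insertAt-punchIn f i v k′) (f≗ k′)

  insertAt-injective : {f : Fin n → A} {i : Fin (suc n)} {v : A} →
    Injective _≡_ _≡_ f → (∀ k → f k ≢ v) → Injective _≡_ _≡_ (insertAt f i v)
  insertAt-injective {f = f} {i} {v} f-injective f≢v {j} {k} eq with punchedView i j | punchedView i k
  ... | at-i       | at-i       = refl
  ... | at-i       | punched k′ =
    contradiction (trans (sym (insertAt-punchIn f i v k′)) (trans (sym eq) (insertAt-lookup f i v))) (f≢v k′)
  ... | punched j′ | at-i       =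
    contradiction (trans (sym (insertAt-punchIn f i v j′)) (trans eq (insertAt-lookup f i v))) (f≢v j′)
  ... | punched j′ | punched k′ =
    cong (punchIn i) (f-injective (trans (sym (insertAt-punchIn f i v j′)) (trans eq (insertAt-punchIn f i v k′))))

  insertAt-cancel : {f f′ : Fin n → A} {i : Fin (suc n)} {v : A} →
    (∀ k → insertAt f i v k ≡ insertAt f′ i v k) → ∀ k → f k ≡ f′ k
  insertAt-cancel {f = f} {f′} {i} {v} eq k =
    trans (sym (insertAt-punchIn f i v k)) (trans (eq (punchIn i k)) (insertAt-punchIn f′ i v k))

fromℕ-≮ : ∀ (x : Fin (suc n)) → ¬ fromℕ n < x
fromℕ-≮ x = ℕ.≤⇒≯ (Fin.≤fromℕ x)

increasing-zero : {e : Fin (suc m) → Fin (suc M)} → StrictlyIncreasing e → ∀ a → e a ≡ zero → a ≡ zero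
increasing-zero increasing zero    _    = refl
increasing-zero {e = e} increasing (suc a) ea≡0 =
  contradiction (subst (e zero <_) ea≡0 (increasing zero (suc a) z<s)) λ ()

increasing-fromℕ : {e : Fin (suc m) → Fin (suc M)} → StrictlyIncreasing e →
  ∀ a → e a ≡ fromℕ M → a ≡ fromℕ m
increasing-fromℕ {m} {e = e} increasing a ea≡max with a ≟ fromℕ m
... | yes a≡last = a≡last
... | no  a≢last =
  contradiction (subst (_< e (fromℕ m)) ea≡max
                        (increasing a (fromℕ m) (Fin.≤∧≢⇒< (Fin.≤fromℕ a) a≢last)))
                (fromℕ-≮ _)

insertAt-avoids : {φ : Fin K → Fin K′} {f : Fin n → Fin K} {i : Fin (suc n)} {v : Fin K′} {σ : Pattern} →
  OrderEmbedding φ → ¬ Containsᶠ f σ →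
  (∀ ((e , _) : Containsᶠ (insertAt (φ ∘ f) i v) σ) a → e a ≢ i) →
  ¬ Containsᶠ (insertAt (φ ∘ f) i v) σ
insertAt-avoids {φ = φ} {f} {i} {v} {σ} φ-embedding f-avoids misses c =
  f-avoids (containsᶠ-sameOrder {σ = σ} (sameOrder-sym (sameOrder-embedding φ-embedding f))
             (containsᶠ-sameOrder {σ = σ} (sameOrder-≗ (removeAt-insertAt (φ ∘ f) i v))
               (containsᶠ-removeAt {g = insertAt (φ ∘ f) i v} {i} {σ} c (misses c))))

-- An extreme entry inserted at an end can only play the first (resp. last) letter of an occurrence,
-- so it creates no occurrence when that letter is not extreme in the pattern.
module _ {σ : Vec ℕ (suc m)} {f : Fin n → Fin K} where

  maxFirst-avoids : ∀ b → lookup σ zero ℕ.< lookup σ b → ¬ Containsᶠ f (suc m , σ) →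
    ¬ Containsᶠ (maxFirst f) (suc m , σ)
  maxFirst-avoids b σ₀<σb f-avoids = insertAt-avoids {σ = suc m , σ} inject₁-embedding f-avoids misses
    where
    misses : ∀ ((e , _) : Containsᶠ (maxFirst f) (suc m , σ)) a → e a ≢ zero
    misses (e , increasing , order) a ea≡0 with increasing-zero increasing a ea≡0
    ... | refl = fromℕ-≮ _ (subst (λ x → maxFirst f x < maxFirst f (e b)) ea≡0
                                  (Equivalence.from (order zero b) σ₀<σb))

  minFirst-avoids : ∀ b → lookup σ b ℕ.< lookup σ zero → ¬ Containsᶠ f (suc m , σ) →
    ¬ Containsᶠ (minFirst f) (suc m , σ)
  minFirst-avoids b σb<σ₀ f-avoids = insertAt-avoids {σ = suc m , σ} suc-embedding f-avoids misses
    where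
    misses : ∀ ((e , _) : Containsᶠ (minFirst f) (suc m , σ)) a → e a ≢ zero
    misses (e , increasing , order) a ea≡0 with increasing-zero increasing a ea≡0
    ... | refl with () ← subst (λ x → minFirst f (e b) < minFirst f x) ea≡0
                                (Equivalence.from (order b zero) σb<σ₀)

  maxLast-avoids : ∀ b → lookup σ (fromℕ m) ℕ.< lookup σ b → ¬ Containsᶠ f (suc m , σ) →
    ¬ Containsᶠ (maxLast f) (suc m , σ)
  maxLast-avoids b σlast<σb f-avoids = insertAt-avoids {σ = suc m , σ} inject₁-embedding f-avoids misses
    where
    misses : ∀ ((e , _) : Containsᶠ (maxLast f) (suc m , σ)) a → e a ≢ fromℕ n
    misses (e , increasing , order) a ea≡last with increasing-fromℕ increasing a ea≡last
    ... | refl = fromℕ-≮ _ (subst (_< maxLast f (e b))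
                                  (trans (cong (maxLast f) ea≡last)
                                         (insertAt-lookup (inject₁ ∘ f) (fromℕ n) (fromℕ K)))
                                  (Equivalence.from (order (fromℕ m) b) σlast<σb))

removeAt-≢ : {g : Fin (suc M) → Fin K} → Injective _≡_ _≡_ g → ∀ i k → removeAt g i k ≢ g i
removeAt-≢ g-injective i k = Fin.punchInᵢ≢i i k ∘ g-injective

inject₁-pinch-fromℕ : ∀ {x : Fin (suc (suc n))} → x ≢ fromℕ (suc n) → inject₁ (pinch (fromℕ n) x) ≡ x
inject₁-pinch-fromℕ {zero}  {zero}     _     = refl
inject₁-pinch-fromℕ {zero}  {suc zero} x≢max = contradiction refl x≢max
inject₁-pinch-fromℕ {suc n} {zero}     _     = refl
inject₁-pinch-fromℕ {suc n} {suc x}    x≢max = cong suc (inject₁-pinch-fromℕ (x≢max ∘ cong suc))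

suc-pinch-zero : ∀ {x : Fin (suc (suc n))} → x ≢ zero → suc (pinch zero x) ≡ x
suc-pinch-zero {x = zero}  x≢0 = contradiction refl x≢0
suc-pinch-zero {x = suc x} _   = refl

module _ {g : Fin (suc M) → Fin (suc (suc n))} (g-injective : Injective _≡_ _≡_ g) (i : Fin (suc M)) where

  deleteMax : g i ≡ fromℕ (suc n) → ∀ k → inject₁ (pinch (fromℕ n) (removeAt g i k)) ≡ removeAt g i k
  deleteMax gi≡max k = inject₁-pinch-fromℕ (subst (removeAt g i k ≢_) gi≡max (removeAt-≢ g-injective i k))

  deleteMin : g i ≡ zero → ∀ k → suc (pinch zero (removeAt g i k)) ≡ removeAt g i k
  deleteMin gi≡0 k = suc-pinch-zero (subst (removeAt g i k ≢_) gi≡0 (removeAt-≢ g-injective i k))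

deletion-preserves : {φ : Fin K → Fin (suc K)} {g : Fin (suc M) → Fin (suc K)} {g′ : Fin M → Fin K}
  {i : Fin (suc M)} {ps : List Pattern} → OrderEmbedding φ → (∀ k → φ (g′ k) ≡ removeAt g i k) →
  Injective _≡_ _≡_ g → Avoidsᶠ g ps → Injective _≡_ _≡_ g′ × Avoidsᶠ g′ ps
deletion-preserves {φ = φ} {g} {g′} {i} φ-embedding φ∘g′≗ g-injective g-avoids =
  (λ {a} {b} eq → Fin.punchIn-injective i a b
                    (g-injective (trans (sym (φ∘g′≗ a)) (trans (cong φ eq) (φ∘g′≗ b))))) ,
  λ σ σ∈ps → g-avoids σ σ∈ps
           ∘ containsᶠ-∘ {g = g} {σ = σ} (punchIn-increasing i)
           ∘ containsᶠ-sameOrder {σ = σ} (sameOrder-≗ φ∘g′≗)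
           ∘ containsᶠ-sameOrder {σ = σ} (sameOrder-embedding φ-embedding g′)

reinsert : {φ : Fin K → Fin (suc K)} {g : Fin (suc M) → Fin (suc K)} {g′ d : Fin M → Fin K}
  {i : Fin (suc M)} {v : Fin (suc K)} {ps : List Pattern} →
  OrderEmbedding φ → (∀ k → φ (g′ k) ≡ removeAt g i k) → v ≡ g i → Injective _≡_ _≡_ g → Avoidsᶠ g ps →
  (Injective _≡_ _≡_ g′ → Avoidsᶠ g′ ps → ∀ k → d k ≡ g′ k) → ∀ k → insertAt (φ ∘ d) i v k ≡ g k
reinsert {φ = φ} {g′ = g′} {ps = ps} φ-embedding φ∘g′≗ v≡ g-injective g-avoids decoded =
  insertAt-≗ (λ k → trans (cong φ (decoded (proj₁ preserved) (proj₂ preserved) k)) (φ∘g′≗ k)) v≡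
  where
  preserved : Injective _≡_ _≡_ g′ × Avoidsᶠ g′ ps
  preserved = deletion-preserves φ-embedding φ∘g′≗ g-injective g-avoids

-- The shape of {213, 231}- and {132, 231}-avoiders

injective⇒surjective : {g : Fin n → Fin n} → Injective _≡_ _≡_ g → ∀ y → ∃ λ x → g x ≡ y
injective⇒surjective {suc n} {g} g-injective y with Fin.any? (λ x → g x ≟ y)
... | yes hit  = hit
... | no  miss = contradiction (Fin.injective⇒≤ squeeze-injective) ℕ.1+n≰n
  where
  squeeze : Fin (suc n) → Fin n
  squeeze x = punchOut {i = y} {j = g x} (miss ∘ (x ,_) ∘ sym)
  squeeze-injective : Injective _≡_ _≡_ squeeze
  squeeze-injective {x} {x′} =
    g-injective ∘ Fin.punchOut-injective {i = y} (miss ∘ (x ,_) ∘ sym) (miss ∘ (x′ ,_) ∘ sym)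

≢zero⇒zero< : {a : Fin (suc n)} → a ≢ zero → Fin.zero {n} < a
≢zero⇒zero< {a = zero}  a≢0 = contradiction refl a≢0
≢zero⇒zero< {a = suc a} _   = z<s

≢fromℕ⇒<fromℕ : {a : Fin (suc n)} → a ≢ fromℕ n → a < fromℕ n
≢fromℕ⇒<fromℕ a≢max = Fin.≤∧≢⇒< (Fin.≤fromℕ _) a≢max

first-is-min : {g : Fin (suc (suc n)) → Fin (suc (suc n))} → Injective _≡_ _≡_ g →
  ¬ Containsᶠ g p213 → ¬ Containsᶠ g p231 → g zero ≢ fromℕ (suc n) → g zero ≡ zero
-- Otherwise the first entry, the minimum and the maximum form a 213 or a 231.
first-is-min {n} {g} g-injective avoids-213 avoids-231 g₀≢max
  with g zero ≟ zero | injective⇒surjective g-injective zero | injective⇒surjective g-injective (fromℕ (suc n))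
... | yes g₀≡0 | _ | _ = g₀≡0
... | no  g₀≢0 | a , ga≡0 | b , gb≡max = ⊥-elim (by-position (Fin.<-cmp a b))
  where
  ga<g₀ : g a < g zero
  ga<g₀ = subst (_< g zero) (sym ga≡0) (≢zero⇒zero< g₀≢0)
  g₀<gb : g zero < g b
  g₀<gb = subst (g zero <_) (sym gb≡max) (≢fromℕ⇒<fromℕ g₀≢max)
  by-position : Tri (a < b) (a ≡ b) (b < a) → ⊥
  by-position (tri< a<b _ _) =
    avoids-213 (contains-213 (≢zero⇒zero< λ { refl → g₀≢0 ga≡0 }) a<b ga<g₀ g₀<gb)
  by-position (tri≈ _ refl _) = contradiction (trans (sym ga≡0) gb≡max) λ ()
  by-position (tri> _ _ b<a) =
    avoids-231 (contains-231 (≢zero⇒zero< λ { refl → g₀≢max gb≡max }) b<a ga<g₀ g₀<gb)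

last-is-max : {g : Fin (suc (suc n)) → Fin (suc (suc n))} → Injective _≡_ _≡_ g →
  ¬ Containsᶠ g p132 → ¬ Containsᶠ g p231 → g zero ≢ fromℕ (suc n) →
  g (fromℕ (suc n)) ≡ fromℕ (suc n)
-- Otherwise the first entry, the maximum and the last entry form a 132 or a 231.
last-is-max {n} {g} g-injective avoids-132 avoids-231 g₀≢max
  with injective⇒surjective g-injective (fromℕ (suc n))
... | b , gb≡max with b ≟ fromℕ (suc n)
... | yes refl   = gb≡max
... | no  b≢last = ⊥-elim (by-value (Fin.<-cmp (g zero) (g (fromℕ (suc n)))))
  where
  0<b : Fin.zero {suc n} < b
  0<b = ≢zero⇒zero< λ { refl → g₀≢max gb≡max }
  b<last : b < fromℕ (suc n)
  b<last = ≢fromℕ⇒<fromℕ b≢last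
  below-gb : ∀ {a} → a ≢ b → g a < g b
  below-gb {a} a≢b =
    subst (g a <_) (sym gb≡max)
          (≢fromℕ⇒<fromℕ (a≢b ∘ g-injective ∘ λ ga≡max → trans ga≡max (sym gb≡max)))
  by-value : Tri (g zero < g (fromℕ (suc n))) (g zero ≡ g (fromℕ (suc n))) (g (fromℕ (suc n)) < g zero) → ⊥
  by-value (tri< g₀<gL _ _) = avoids-132 (contains-132 0<b b<last g₀<gL (below-gb (b≢last ∘ sym)))
  by-value (tri≈ _ g₀≡gL _) = contradiction (g-injective g₀≡gL) λ ()
  by-value (tri> _ _ gL<g₀) =
    avoids-231 (contains-231 0<b b<last gL<g₀ (below-gb λ { refl → g₀≢max gb≡max }))

⟦_⟧ : Bool → ℕ
⟦ true  ⟧ = 1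
⟦ false ⟧ = 0

isFixed isExcedance : ℕ → ℕ → Bool
isFixed     p v = v ≡ᵇ p
isExcedance p v = p <ᵇ v

ShiftInvariant : (ℕ → ℕ → Bool) → Set
ShiftInvariant R = ∀ p v → R (suc p) (suc v) ≡ R p v

isFixed-shiftInvariant : ShiftInvariant isFixed
isFixed-shiftInvariant p v = refl

isExcedance-shiftInvariant : ShiftInvariant isExcedance
isExcedance-shiftInvariant p v = refl

shiftInvariant-+ : ∀ {R} → ShiftInvariant R → ∀ k p v → R (p + k) (v + k) ≡ R p v
shiftInvariant-+ {R} inv zero    p v = cong₂ R (ℕ.+-identityʳ p) (ℕ.+-identityʳ v)
shiftInvariant-+ {R} inv (suc k) p v =
  trans (cong₂ R (ℕ.+-suc p k) (ℕ.+-suc v k)) (trans (inv (p + k) (v + k)) (shiftInvariant-+ inv k p v))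

-- The offset d keeps the original positions of the entries after d entries were removed in front.
countAt : (ℕ → ℕ → Bool) → ℕ → (Fin m → Fin K) → ℕ
countAt R d g = sum λ k → ⟦ R (d + toℕ k) (toℕ (g k)) ⟧

length-filter-tabulate : ∀ {A : Set} {P : A → Set} (P? : Decidable P) (f : Fin n → A) →
  List.length (List.filter P? (List.tabulate f)) ≡ sum (λ k → ⟦ does (P? (f k)) ⟧)
length-filter-tabulate {zero}  P? f = refl
length-filter-tabulate {suc n} P? f with does (P? (f zero))
... | true  = cong suc (length-filter-tabulate P? (f ∘ suc))
... | false = length-filter-tabulate P? (f ∘ suc)

does-≟ : ∀ (x y : Fin n) → does (x ≟ y) ≡ (toℕ x ≡ᵇ toℕ y)
does-≟ zero    zero    = refl
does-≟ zero    (suc y) = refl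
does-≟ (suc x) zero    = refl
does-≟ (suc x) (suc y) = does-≟ x y

fp≡countAt : ∀ (π : Vec (Fin n) n) → fp π ≡ countAt isFixed 0 (lookup π)
fp≡countAt π =
  trans (length-filter-tabulate (λ i → lookup π i ≟ i) (λ k → k))
        (sum-cong-≗ λ k → cong ⟦_⟧ (does-≟ (lookup π k) k))

exc≡countAt : ∀ (π : Vec (Fin n) n) → exc π ≡ countAt isExcedance 0 (lookup π)
exc≡countAt π = length-filter-tabulate (λ i → i <? lookup π i) (λ k → k)

countAt-cong : ∀ R d {g g′ : Fin m → Fin K} → (∀ k → g k ≡ g′ k) → countAt R d g ≡ countAt R d g′
countAt-cong R d g≗g′ = sum-cong-≗ λ k → cong (λ x → ⟦ R (d + toℕ k) (toℕ x) ⟧) (g≗g′ k)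

countAt-inject₁ : ∀ R d (f : Fin m → Fin K) → countAt R d (inject₁ ∘ f) ≡ countAt R d f
countAt-inject₁ R d f = sum-cong-≗ λ k → cong (λ x → ⟦ R (d + toℕ k) x ⟧) (Fin.toℕ-inject₁ (f k))

countAt-suc : ∀ {R} → ShiftInvariant R → ∀ d (f : Fin m → Fin K) →
  countAt R (suc d) (suc ∘ f) ≡ countAt R d f
countAt-suc inv d f = sum-cong-≗ λ k → cong ⟦_⟧ (inv (d + toℕ k) (toℕ (f k)))

countAt-singleton : ∀ R d (g : Fin 1 → Fin K) → countAt R d g ≡ ⟦ R d (toℕ (g zero)) ⟧
countAt-singleton R d g = trans (ℕ.+-identityʳ _) (cong (λ p → ⟦ R p (toℕ (g zero)) ⟧) (ℕ.+-identityʳ d))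

countAt-insertAt-zero : ∀ R d (f : Fin m → Fin K) v →
  countAt R d (insertAt f zero v) ≡ ⟦ R d (toℕ v) ⟧ + countAt R (suc d) f
countAt-insertAt-zero R d f v =
  cong₂ _+_ (cong (λ p → ⟦ R p (toℕ v) ⟧) (ℕ.+-identityʳ d))
            (sum-cong-≗ λ k → cong (λ p → ⟦ R p (toℕ (f k)) ⟧) (ℕ.+-suc d (toℕ k)))

punchIn-fromℕ : ∀ (k : Fin n) → punchIn (fromℕ n) k ≡ inject₁ k
punchIn-fromℕ zero    = refl
punchIn-fromℕ (suc k) = cong suc (punchIn-fromℕ k)

countAt-insertAt-fromℕ : ∀ R d (f : Fin m → Fin K) v →
  countAt R d (insertAt f (fromℕ m) v) ≡ ⟦ R (d + m) (toℕ v) ⟧ + countAt R d f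
countAt-insertAt-fromℕ {m} R d f v =
  trans (sum-remove {i = fromℕ m} λ k → ⟦ R (d + toℕ k) (toℕ (insertAt f (fromℕ m) v k)) ⟧)
        (cong₂ _+_ (cong₂ (λ p x → ⟦ R (d + p) (toℕ x) ⟧) (Fin.toℕ-fromℕ m) (insertAt-lookup f (fromℕ m) v))
                   (sum-cong-≗ λ k → cong₂ (λ p x → ⟦ R (d + p) (toℕ x) ⟧)
                                           (trans (cong toℕ (punchIn-fromℕ k)) (Fin.toℕ-inject₁ k))
                                           (insertAt-punchIn f (fromℕ m) v k)))

countAt-maxFirst : ∀ R d (f : Fin n → Fin K) → countAt R d (maxFirst f) ≡ ⟦ R d K ⟧ + countAt R (suc d) f
countAt-maxFirst {K = K} R d f =
  trans (countAt-insertAt-zero R d (inject₁ ∘ f) (fromℕ K))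
        (cong₂ _+_ (cong (λ v → ⟦ R d v ⟧) (Fin.toℕ-fromℕ K)) (countAt-inject₁ R (suc d) f))

countAt-minFirst : ∀ {R} → ShiftInvariant R → ∀ d (f : Fin n → Fin K) →
  countAt R d (minFirst f) ≡ ⟦ R d 0 ⟧ + countAt R d f
countAt-minFirst {R = R} inv d f =
  trans (countAt-insertAt-zero R d (suc ∘ f) zero) (cong (_+_ ⟦ R d 0 ⟧) (countAt-suc inv d f))

countAt-maxLast : ∀ {R} → ShiftInvariant R → ∀ d (f : Fin n → Fin n) →
  countAt R d (maxLast f) ≡ ⟦ R d 0 ⟧ + countAt R d f
countAt-maxLast {n} {R} inv d f =
  trans (countAt-insertAt-fromℕ R d (inject₁ ∘ f) (fromℕ n))
        (cong₂ _+_ (cong ⟦_⟧ (trans (cong (R (d + n)) (Fin.toℕ-fromℕ n)) (shiftInvariant-+ inv n d 0)))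
                   (countAt-inject₁ R d f))

-- Words and their generating polynomials

-- The R-statistic, with offset d, of the permutation coded by a word under either encoding below.
wordStat : (ℕ → ℕ → Bool) → ℕ → Vec Bool n → ℕ
wordStat R d []                = ⟦ R d 0 ⟧
wordStat R d (_∷_ {n} true  w) = ⟦ R d (suc n) ⟧ + wordStat R (suc d) w
wordStat R d (false ∷ w)       = ⟦ R d 0 ⟧ + wordStat R d w

WordsWith : ℕ → ℕ → ℕ → ℕ → Set
WordsWith d n i j = Σ (Vec Bool n) λ w → wordStat isFixed d w ≡ i × wordStat isExcedance d w ≡ j

-- Polynomials in x and q: P i j is the coefficient of x^i q^j.
Poly : Set
Poly = ℕ → ℕ → ℕ

infix 4 _≗₂_
_≗₂_ : Poly → Poly → Set
P ≗₂ Q = ∀ i j → P i j ≡ Q i j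

unit : Poly
unit zero zero = 1
unit _    _    = 0

infixl 6 _⊞_
_⊞_ : Poly → Poly → Poly
(P ⊞ Q) i j = P i j + Q i j

infixr 8 x^[_]·_ q^[_]·_ [_↦_]·_
x^[_]·_ q^[_]·_ : Bool → Poly → Poly
(x^[ false ]· P) i       j = P i j
(x^[ true  ]· P) zero    j = 0
(x^[ true  ]· P) (suc i) j = P i j
(q^[ false ]· P) i j       = P i j
(q^[ true  ]· P) i zero    = 0
(q^[ true  ]· P) i (suc j) = P i j

[_↦_]·_ : ℕ → ℕ → Poly → Poly
[ p ↦ v ]· P = x^[ isFixed p v ]· q^[ isExcedance p v ]· P

wordPoly : ℕ → ℕ → Poly
wordPoly d zero    = [ d ↦ 0 ]· unit
wordPoly d (suc n) = [ d ↦ suc n ]· wordPoly (suc d) n ⊞ [ d ↦ 0 ]· wordPoly d n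

Counts : (W : Set) → (W → ℕ) → (W → ℕ) → Poly → Set
Counts W s t P = ∀ i j → Fin (P i j) ↔ Σ W (λ w → s w ≡ i × t w ≡ j)

Fin0↔ : {A : Set} → ¬ A → Fin 0 ↔ A
Fin0↔ ¬a = mk↔ₛ′ (λ ()) (⊥-elim ∘ ¬a) (⊥-elim ∘ ¬a) (λ ())

counts-cong : ∀ {W s s′ t t′ P} → (∀ w → s w ≡ s′ w) → (∀ w → t w ≡ t′ w) →
  Counts W s t P → Counts W s′ t′ P
counts-cong s≗s′ t≗t′ counts i j = ↔-trans (counts i j) (mk↔ₛ′
  (λ (w , p , q) → w , trans (sym (s≗s′ w)) p , trans (sym (t≗t′ w)) q)
  (λ (w , p , q) → w , trans (s≗s′ w) p , trans (t≗t′ w) q)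
  (λ (w , p , q) → cong₂ (λ p q → w , p , q) (ℕ.≡-irrelevant _ _) (ℕ.≡-irrelevant _ _))
  (λ (w , p , q) → cong₂ (λ p q → w , p , q) (ℕ.≡-irrelevant _ _) (ℕ.≡-irrelevant _ _)))

counts-x : ∀ {W s t P} b → Counts W s t P → Counts W (λ w → ⟦ b ⟧ + s w) t (x^[ b ]· P)
counts-x false counts = counts
counts-x true  counts zero    j = Fin0↔ λ { (w , () , _) }
counts-x true  counts (suc i) j = ↔-trans (counts i j) (mk↔ₛ′
  (λ (w , p , q) → w , cong suc p , q) (λ (w , p , q) → w , ℕ.suc-injective p , q)
  (λ (w , p , q) → cong (λ p → w , p , q) (ℕ.≡-irrelevant _ _))
  (λ (w , p , q) → cong (λ p → w , p , q) (ℕ.≡-irrelevant _ _)))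

counts-q : ∀ {W s t P} b → Counts W s t P → Counts W s (λ w → ⟦ b ⟧ + t w) (q^[ b ]· P)
counts-q false counts = counts
counts-q true  counts i zero    = Fin0↔ λ { (w , _ , ()) }
counts-q true  counts i (suc j) = ↔-trans (counts i j) (mk↔ₛ′
  (λ (w , p , q) → w , p , cong suc q) (λ (w , p , q) → w , p , ℕ.suc-injective q)
  (λ (w , p , q) → cong (λ q → w , p , q) (ℕ.≡-irrelevant _ _))
  (λ (w , p , q) → cong (λ q → w , p , q) (ℕ.≡-irrelevant _ _)))

counts-↦ : ∀ {W s t P} p v → Counts W s t P →
  Counts W (λ w → ⟦ isFixed p v ⟧ + s w) (λ w → ⟦ isExcedance p v ⟧ + t w) ([ p ↦ v ]· P)
counts-↦ p v = counts-x (isFixed p v) ∘ counts-q (isExcedance p v)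

counts-unit : Counts (Vec Bool 0) (λ _ → 0) (λ _ → 0) unit
counts-unit zero    zero    =
  mk↔ₛ′ (λ _ → [] , refl , refl) (λ _ → zero) (λ { ([] , refl , refl) → refl }) (λ { zero → refl })
counts-unit zero    (suc j) = Fin0↔ λ { (_ , _ , ()) }
counts-unit (suc i) j       = Fin0↔ λ { (_ , () , _) }

Σ-Vec-Bool-∷ : (P : Vec Bool (suc n) → Set) →
  Σ (Vec Bool (suc n)) P ↔ (Σ (Vec Bool n) (P ∘ (true ∷_)) ⊎ Σ (Vec Bool n) (P ∘ (false ∷_)))
Σ-Vec-Bool-∷ P = mk↔ₛ′ split join split∘join join∘split
  where
  split : Σ _ P → _
  split (true  ∷ w , p) = inj₁ (w , p)
  split (false ∷ w , p) = inj₂ (w , p)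
  join : _ → Σ _ P
  join (inj₁ (w , p)) = true  ∷ w , p
  join (inj₂ (w , p)) = false ∷ w , p
  split∘join : ∀ y → split (join y) ≡ y
  split∘join (inj₁ _) = refl
  split∘join (inj₂ _) = refl
  join∘split : ∀ x → join (split x) ≡ x
  join∘split (true  ∷ _ , _) = refl
  join∘split (false ∷ _ , _) = refl

wordPoly-counts : ∀ d n i j → Fin (wordPoly d n i j) ↔ WordsWith d n i j
wordPoly-counts d zero =
  counts-cong (λ { [] → ℕ.+-identityʳ _ }) (λ { [] → ℕ.+-identityʳ _ }) (counts-↦ d 0 counts-unit)
wordPoly-counts d (suc n) i j =
  ↔-trans (Fin.+↔⊎ {m = ([ d ↦ suc n ]· wordPoly (suc d) n) i j})
          (↔-trans (counts-↦ d (suc n) (wordPoly-counts (suc d) n) i j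
                      ⊎-↔ counts-↦ d 0 (wordPoly-counts d n) i j)
                   (↔-sym (Σ-Vec-Bool-∷ _)))

x^-cong : ∀ b {P Q} → P ≗₂ Q → x^[ b ]· P ≗₂ x^[ b ]· Q
x^-cong false P≗Q i       j = P≗Q i j
x^-cong true  P≗Q zero    j = refl
x^-cong true  P≗Q (suc i) j = P≗Q i j

q^-cong : ∀ b {P Q} → P ≗₂ Q → q^[ b ]· P ≗₂ q^[ b ]· Q
q^-cong false P≗Q i j       = P≗Q i j
q^-cong true  P≗Q i zero    = refl
q^-cong true  P≗Q i (suc j) = P≗Q i j

x^-distrib-⊞ : ∀ b P Q → x^[ b ]· (P ⊞ Q) ≗₂ x^[ b ]· P ⊞ x^[ b ]· Q
x^-distrib-⊞ false P Q i       j = refl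
x^-distrib-⊞ true  P Q zero    j = refl
x^-distrib-⊞ true  P Q (suc i) j = refl

q^-distrib-⊞ : ∀ b P Q → q^[ b ]· (P ⊞ Q) ≗₂ q^[ b ]· P ⊞ q^[ b ]· Q
q^-distrib-⊞ false P Q i j       = refl
q^-distrib-⊞ true  P Q i zero    = refl
q^-distrib-⊞ true  P Q i (suc j) = refl

↦-distrib-⊞ : ∀ p v P Q → [ p ↦ v ]· (P ⊞ Q) ≗₂ [ p ↦ v ]· P ⊞ [ p ↦ v ]· Q
↦-distrib-⊞ p v P Q i j =
  trans (x^-cong (isFixed p v) (q^-distrib-⊞ (isExcedance p v) P Q) i j)
        (x^-distrib-⊞ (isFixed p v) _ _ i j)

wordPoly-double : ∀ d k → wordPoly (2 + d) (suc k) ≗₂ wordPoly (suc d) k ⊞ wordPoly (suc d) k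
wordPoly-double d zero    i j = refl
wordPoly-double d (suc k) i j = begin
  ([ 2 + d ↦ 2 + k ]· wordPoly (3 + d) (suc k)) i j + wordPoly (2 + d) (suc k) i j
    ≡⟨ cong₂ _+_ (x^-cong (isFixed (suc d) (suc k))
                          (q^-cong (isExcedance (suc d) (suc k)) (wordPoly-double (suc d) k)) i j)
                 (wordPoly-double d k i j) ⟩
  ([ 1 + d ↦ 1 + k ]· (A ⊞ A)) i j + (B i j + B i j)
    ≡⟨ cong (_+ (B i j + B i j)) (↦-distrib-⊞ (suc d) (suc k) A A i j) ⟩
  (([ 1 + d ↦ 1 + k ]· A) i j + ([ 1 + d ↦ 1 + k ]· A) i j) + (B i j + B i j)
    ≡⟨ ℕ-interchange (([ 1 + d ↦ 1 + k ]· A) i j) (([ 1 + d ↦ 1 + k ]· A) i j) (B i j) (B i j) ⟩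
  wordPoly (suc d) (suc k) i j + wordPoly (suc d) (suc k) i j ∎
  where
  open ≡-Reasoning
  A B : Poly
  A = wordPoly (2 + d) k
  B = wordPoly (1 + d) k

avoiderCount : ℕ → ℕ → ℕ → ℕ
avoiderCount zero    = unit
avoiderCount (suc n) = wordPoly 0 n

-- Encoding avoiders by words

record WordEncoding (ps : List Pattern) : Set where
  field
    decode               : Vec Bool n → Fin (suc n) → Fin (suc n)
    encode               : (Fin (suc n) → Fin (suc n)) → Vec Bool n
    decode-injective     : {w w′ : Vec Bool n} → (∀ k → decode w k ≡ decode w′ k) → w ≡ w′
    decode-isPermutation : (w : Vec Bool n) → Injective _≡_ _≡_ (decode w)
    decode-avoids        : (w : Vec Bool n) → Avoidsᶠ (decode w) ps
    decode-encode        : {g : Fin (suc n) → Fin (suc n)} → Injective _≡_ _≡_ g → Avoidsᶠ g ps →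
                           ∀ k → decode (encode g) k ≡ g k
    countAt-decode       : ∀ R → ShiftInvariant R → (w : Vec Bool n) → countAt R 0 (decode w) ≡ wordStat R 0 w

words-≡ : ∀ {d i j} {w w′ : Vec Bool n} {p p′ q q′} → w ≡ w′ →
  _≡_ {A = WordsWith d n i j} (w , p , q) (w′ , p′ , q′)
words-≡ {w = w} refl = cong₂ (λ p q → w , p , q) (ℕ.≡-irrelevant _ _) (ℕ.≡-irrelevant _ _)

module _ {ps : List Pattern} (E : WordEncoding ps) where
  open WordEncoding E

  avoiders↔words : ∀ {i j} → AvoidSet ps (suc n) i j ↔ WordsWith 0 n i j
  avoiders↔words {n} {i} {j} = mk↔ₛ′ to from to∘from from∘to
    where
    Valid : Vec (Fin (suc n)) (suc n) → Set
    Valid π = IsPerm π × Avoids π ps × fp π ≡ i × exc π ≡ j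

    encode-stat : ∀ R → ShiftInvariant R → (g : Fin (suc n) → Fin (suc n)) → Injective _≡_ _≡_ g →
                  Avoidsᶠ g ps → wordStat R 0 (encode g) ≡ countAt R 0 g
    encode-stat R inv g g-injective g-avoids =
      trans (sym (countAt-decode R inv (encode g))) (countAt-cong R 0 (decode-encode g-injective g-avoids))

    encode-fp : ∀ π → Valid π → wordStat isFixed 0 (encode (lookup π)) ≡ i
    encode-fp π (isPerm , avoids , fp≡i , _) =
      trans (encode-stat isFixed isFixed-shiftInvariant (lookup π) (isPerm _ _) avoids)
            (trans (sym (fp≡countAt π)) fp≡i)

    encode-exc : ∀ π → Valid π → wordStat isExcedance 0 (encode (lookup π)) ≡ j
    encode-exc π (isPerm , avoids , _ , exc≡j) =
      trans (encode-stat isExcedance isExcedance-shiftInvariant (lookup π) (isPerm _ _) avoids)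
            (trans (sym (exc≡countAt π)) exc≡j)

    decode-encode-tabulate : ∀ π → Valid π → tabulate (decode (encode (lookup π))) ≡ π
    decode-encode-tabulate π (isPerm , avoids , _) =
      trans (tabulate-cong (decode-encode (isPerm _ _) avoids)) (tabulate∘lookup π)

    to : AvoidSet ps (suc n) i j → WordsWith 0 n i j
    to (π , [ valid ]) =
      encode (lookup π) , recompute (_ ℕ.≟ i) (encode-fp π valid) , recompute (_ ℕ.≟ j) (encode-exc π valid)

    module Decoded (w : Vec Bool n) where
      lookup-decode : ∀ k → lookup (tabulate (decode w)) k ≡ decode w k
      lookup-decode = lookup∘tabulate (decode w)
      isPerm : IsPerm (tabulate (decode w))
      isPerm a b eq = decode-isPermutation w (trans (sym (lookup-decode a)) (trans eq (lookup-decode b)))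
      avoids : Avoids (tabulate (decode w)) ps
      avoids = avoidsᶠ-≗ (sym ∘ lookup-decode) (decode-avoids w)
      stat : ∀ R → ShiftInvariant R → countAt R 0 (lookup (tabulate (decode w))) ≡ wordStat R 0 w
      stat R inv = trans (countAt-cong R 0 lookup-decode) (countAt-decode R inv w)

    from : WordsWith 0 n i j → AvoidSet ps (suc n) i j
    from (w , fp≡i , exc≡j) =
      tabulate (decode w) ,
      [ isPerm
      , avoids
      , trans (fp≡countAt (tabulate (decode w))) (trans (stat isFixed isFixed-shiftInvariant) fp≡i)
      , trans (exc≡countAt (tabulate (decode w))) (trans (stat isExcedance isExcedance-shiftInvariant) exc≡j)
      ]
      where open Decoded w

    to∘from : ∀ x → to (from x) ≡ x
    to∘from (w , _ , _) = words-≡ (decode-injective λ k →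
      trans (decode-encode (isPerm _ _) avoids k) (lookup-decode k))
      where open Decoded w

    from∘to : ∀ x → from (to x) ≡ x
    from∘to (π , [ valid ]) = value-injective (recompute (≡-dec _≟_ _ π) (decode-encode-tabulate π valid))

emptyAvoiders↔ : {g : Fin M → Fin K} {ps : List Pattern} → Avoidsᶠ g ps →
  ∀ i j → Fin (unit i j) ↔ AvoidSet ps 0 i j
emptyAvoiders↔ {g = g} g-avoids zero zero =
  mk↔ₛ′ (λ _ → [] , [ (λ ()) , empty-avoids {g = g} {h = lookup []} g-avoids , refl , refl ]) (λ _ → zero)
        (λ { ([] , _) → refl }) (λ { zero → refl })
emptyAvoiders↔ g-avoids zero    (suc j) =
  Fin0↔ λ { ([] , [ valid ]) → Irrelevant.⊥-elim (ℕ.0≢1+n (proj₂ (proj₂ (proj₂ valid)))) }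
emptyAvoiders↔ g-avoids (suc i) j       =
  Fin0↔ λ { ([] , [ valid ]) → Irrelevant.⊥-elim (ℕ.0≢1+n (proj₁ (proj₂ (proj₂ valid)))) }

avoiders-counted : ∀ {ps c} → WordEncoding ps → IsCount ps c → ∀ n i j → c n i j ≡ avoiderCount n i j
avoiders-counted E count zero    i j =
  ↔⇒≡ (↔-trans (count 0 i j) (↔-sym (emptyAvoiders↔ {g = decode []} (decode-avoids []) i j)))
  where open WordEncoding E
avoiders-counted E count (suc n) i j =
  ↔⇒≡ (↔-trans (count (suc n) i j) (↔-trans (avoiders↔words E) (↔-sym (wordPoly-counts 0 n i j))))

-- {132, 231}-avoiders: the maximum comes first or last.
module MaxFirstOrLast where

  ps : List Pattern
  ps = p132 ∷ p231 ∷ []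

  decode : Vec Bool n → Fin (suc n) → Fin (suc n)
  decode []          = λ _ → zero
  decode (true  ∷ w) = maxFirst (decode w)
  decode (false ∷ w) = maxLast (decode w)

  encode : (Fin (suc n) → Fin (suc n)) → Vec Bool n
  encode {zero}  g = []
  encode {suc n} g with g zero ≟ fromℕ (suc n)
  ... | yes _ = true  ∷ encode (pinch (fromℕ n) ∘ removeAt g zero)
  ... | no  _ = false ∷ encode (pinch (fromℕ n) ∘ removeAt g (fromℕ (suc n)))

  decode-injective : {w w′ : Vec Bool n} → (∀ k → decode w k ≡ decode w′ k) → w ≡ w′
  decode-injective {w = []}        {[]}         _  = refl
  decode-injective {w = true ∷ w}  {true ∷ w′}  eq =
    cong (true ∷_) (decode-injective (Fin.inject₁-injective ∘ insertAt-cancel {i = zero} eq))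
  decode-injective {w = _∷_ {n} false w} {false ∷ w′} eq =
    cong (false ∷_) (decode-injective (Fin.inject₁-injective ∘ insertAt-cancel {i = fromℕ (suc n)} eq))
  decode-injective {w = true ∷ w}  {false ∷ w′} eq = contradiction (eq zero) Fin.fromℕ≢inject₁
  decode-injective {w = false ∷ w} {true ∷ w′}  eq = contradiction (sym (eq zero)) Fin.fromℕ≢inject₁

  decode-isPermutation : (w : Vec Bool n) → Injective _≡_ _≡_ (decode w)
  decode-isPermutation []                {zero} {zero} _ = refl
  decode-isPermutation (true ∷ w)        =
    insertAt-injective {i = zero} (decode-isPermutation w ∘ Fin.inject₁-injective)
                                  (λ _ → Fin.fromℕ≢inject₁ ∘ sym)
  decode-isPermutation (_∷_ {n} false w) =
    insertAt-injective {i = fromℕ (suc n)} (decode-isPermutation w ∘ Fin.inject₁-injective)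
                                           (λ _ → Fin.fromℕ≢inject₁ ∘ sym)

  decode-avoids : (w : Vec Bool n) → Avoidsᶠ (decode w) ps
  decode-avoids []          = singleton-avoids {g = decode []} (ℕ.<ᵇ⇒< 1 3 _ ∷ ℕ.<ᵇ⇒< 1 3 _ ∷ [])
  decode-avoids (true ∷ w)  _ (here refl)         =
    maxFirst-avoids {σ = proj₂ p132} 1F (ℕ.<ᵇ⇒< 1 3 _) (decode-avoids w _ (here refl))
  decode-avoids (true ∷ w)  _ (there (here refl)) =
    maxFirst-avoids {σ = proj₂ p231} 1F (ℕ.<ᵇ⇒< 2 3 _) (decode-avoids w _ (there (here refl)))
  decode-avoids (false ∷ w) _ (here refl)         =
    maxLast-avoids {σ = proj₂ p132} 1F (ℕ.<ᵇ⇒< 2 3 _) (decode-avoids w _ (here refl))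
  decode-avoids (false ∷ w) _ (there (here refl)) =
    maxLast-avoids {σ = proj₂ p231} 0F (ℕ.<ᵇ⇒< 1 2 _) (decode-avoids w _ (there (here refl)))

  decode-encode : {g : Fin (suc n) → Fin (suc n)} → Injective _≡_ _≡_ g → Avoidsᶠ g ps →
                  ∀ k → decode (encode g) k ≡ g k
  decode-encode {zero}  {g} _ _ zero with g zero
  ... | zero = refl
  decode-encode {suc n} {g} g-injective g-avoids with g zero ≟ fromℕ (suc n)
  ... | yes g₀≡max = reinsert inject₁-embedding (deleteMax g-injective zero g₀≡max) (sym g₀≡max)
                                g-injective g-avoids decode-encode
  ... | no  g₀≢max = reinsert inject₁-embedding (deleteMax g-injective (fromℕ (suc n)) gL≡max) (sym gL≡max)
                                g-injective g-avoids decode-encode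
    where
    gL≡max : g (fromℕ (suc n)) ≡ fromℕ (suc n)
    gL≡max = last-is-max g-injective (g-avoids _ (here refl)) (g-avoids _ (there (here refl))) g₀≢max

  countAt-decode : ∀ R → ShiftInvariant R → ∀ d (w : Vec Bool n) → countAt R d (decode w) ≡ wordStat R d w
  countAt-decode R inv d []          = countAt-singleton R d (decode [])
  countAt-decode R inv d (true ∷ w)  =
    trans (countAt-maxFirst R d (decode w)) (cong (_+_ ⟦ R d _ ⟧) (countAt-decode R inv (suc d) w))
  countAt-decode R inv d (false ∷ w) =
    trans (countAt-maxLast inv d (decode w)) (cong (_+_ ⟦ R d 0 ⟧) (countAt-decode R inv d w))

  encoding : WordEncoding ps
  encoding = record
    { decode               = decode
    ; encode               = encode
    ; decode-injective     = decode-injective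
    ; decode-isPermutation = decode-isPermutation
    ; decode-avoids        = decode-avoids
    ; decode-encode        = decode-encode
    ; countAt-decode       = λ R inv → countAt-decode R inv 0
    }

-- {213, 231}-avoiders: the first entry is the maximum or the minimum.
module MaxOrMinFirst where

  ps : List Pattern
  ps = p213 ∷ p231 ∷ []

  decode : Vec Bool n → Fin (suc n) → Fin (suc n)
  decode []          = λ _ → zero
  decode (true  ∷ w) = maxFirst (decode w)
  decode (false ∷ w) = minFirst (decode w)

  encode : (Fin (suc n) → Fin (suc n)) → Vec Bool n
  encode {zero}  g = []
  encode {suc n} g with g zero ≟ fromℕ (suc n)
  ... | yes _ = true  ∷ encode (pinch (fromℕ n) ∘ removeAt g zero)
  ... | no  _ = false ∷ encode (pinch zero ∘ removeAt g zero)

  decode-injective : {w w′ : Vec Bool n} → (∀ k → decode w k ≡ decode w′ k) → w ≡ w′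
  decode-injective {w = []}        {[]}         _  = refl
  decode-injective {w = true ∷ w}  {true ∷ w′}  eq =
    cong (true ∷_) (decode-injective (Fin.inject₁-injective ∘ insertAt-cancel {i = zero} eq))
  decode-injective {w = false ∷ w} {false ∷ w′} eq =
    cong (false ∷_) (decode-injective (Fin.suc-injective ∘ insertAt-cancel {i = zero} eq))
  decode-injective {w = true ∷ w}  {false ∷ w′} eq = contradiction (eq zero) λ ()
  decode-injective {w = false ∷ w} {true ∷ w′}  eq = contradiction (eq zero) λ ()

  decode-isPermutation : (w : Vec Bool n) → Injective _≡_ _≡_ (decode w)
  decode-isPermutation []          {zero} {zero} _ = refl
  decode-isPermutation (true ∷ w)  =
    insertAt-injective {i = zero} (decode-isPermutation w ∘ Fin.inject₁-injective)
                                  (λ _ → Fin.fromℕ≢inject₁ ∘ sym)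
  decode-isPermutation (false ∷ w) =
    insertAt-injective {i = zero} (decode-isPermutation w ∘ Fin.suc-injective) (λ _ ())

  decode-avoids : (w : Vec Bool n) → Avoidsᶠ (decode w) ps
  decode-avoids []          = singleton-avoids {g = decode []} (ℕ.<ᵇ⇒< 1 3 _ ∷ ℕ.<ᵇ⇒< 1 3 _ ∷ [])
  decode-avoids (true ∷ w)  _ (here refl)         =
    maxFirst-avoids {σ = proj₂ p213} 2F (ℕ.<ᵇ⇒< 2 3 _) (decode-avoids w _ (here refl))
  decode-avoids (true ∷ w)  _ (there (here refl)) =
    maxFirst-avoids {σ = proj₂ p231} 1F (ℕ.<ᵇ⇒< 2 3 _) (decode-avoids w _ (there (here refl)))
  decode-avoids (false ∷ w) _ (here refl)         =
    minFirst-avoids {σ = proj₂ p213} 1F (ℕ.<ᵇ⇒< 1 2 _) (decode-avoids w _ (here refl))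
  decode-avoids (false ∷ w) _ (there (here refl)) =
    minFirst-avoids {σ = proj₂ p231} 2F (ℕ.<ᵇ⇒< 1 2 _) (decode-avoids w _ (there (here refl)))

  decode-encode : {g : Fin (suc n) → Fin (suc n)} → Injective _≡_ _≡_ g → Avoidsᶠ g ps →
                  ∀ k → decode (encode g) k ≡ g k
  decode-encode {zero}  {g} _ _ zero with g zero
  ... | zero = refl
  decode-encode {suc n} {g} g-injective g-avoids with g zero ≟ fromℕ (suc n)
  ... | yes g₀≡max = reinsert inject₁-embedding (deleteMax g-injective zero g₀≡max) (sym g₀≡max)
                                g-injective g-avoids decode-encode
  ... | no  g₀≢max = reinsert suc-embedding (deleteMin g-injective zero g₀≡0) (sym g₀≡0)
                                g-injective g-avoids decode-encode
    where
    g₀≡0 : g zero ≡ zero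
    g₀≡0 = first-is-min g-injective (g-avoids _ (here refl)) (g-avoids _ (there (here refl))) g₀≢max

  countAt-decode : ∀ R → ShiftInvariant R → ∀ d (w : Vec Bool n) → countAt R d (decode w) ≡ wordStat R d w
  countAt-decode R inv d []          = countAt-singleton R d (decode [])
  countAt-decode R inv d (true ∷ w)  =
    trans (countAt-maxFirst R d (decode w)) (cong (_+_ ⟦ R d _ ⟧) (countAt-decode R inv (suc d) w))
  countAt-decode R inv d (false ∷ w) =
    trans (countAt-minFirst inv d (decode w)) (cong (_+_ ⟦ R d 0 ⟧) (countAt-decode R inv d w))

  encoding : WordEncoding ps
  encoding = record
    { decode               = decode
    ; encode               = encode
    ; decode-injective     = decode-injective
    ; decode-isPermutation = decode-isPermutation
    ; decode-avoids        = decode-avoids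
    ; decode-encode        = decode-encode
    ; countAt-decode       = λ R inv → countAt-decode R inv 0
    }

-- Formal power series

infix 4 _≐_
_≐_ : PS → PS → Set
f ≐ g = ∀ n i j → f n i j ≡ g n i j

∑≤-cong : ∀ n {f g : ℕ → ℤ} → (∀ k → k ℕ.≤ n → f k ≡ g k) → ∑≤ n f ≡ ∑≤ n g
∑≤-cong zero    f≗g = f≗g 0 z≤n
∑≤-cong (suc n) f≗g =
  cong₂ ℤ._+_ (∑≤-cong n (λ k k≤n → f≗g k (ℕ.m≤n⇒m≤1+n k≤n))) (f≗g (suc n) ℕ.≤-refl)

∑≤-cong′ : ∀ n {f g : ℕ → ℤ} → (∀ k → f k ≡ g k) → ∑≤ n f ≡ ∑≤ n g
∑≤-cong′ n f≗g = ∑≤-cong n (λ k _ → f≗g k)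

∑≤-zero : ∀ n {f : ℕ → ℤ} → (∀ k → k ℕ.≤ n → f k ≡ + 0) → ∑≤ n f ≡ + 0
∑≤-zero zero    f≗0 = f≗0 0 z≤n
∑≤-zero (suc n) f≗0 =
  cong₂ ℤ._+_ (∑≤-zero n (λ k k≤n → f≗0 k (ℕ.m≤n⇒m≤1+n k≤n))) (f≗0 (suc n) ℕ.≤-refl)

∑≤-distrib-+ : ∀ n (f g : ℕ → ℤ) → ∑≤ n (λ k → f k ℤ.+ g k) ≡ ∑≤ n f ℤ.+ ∑≤ n g
∑≤-distrib-+ zero    f g = refl
∑≤-distrib-+ (suc n) f g =
  trans (cong (ℤ._+ (f (suc n) ℤ.+ g (suc n))) (∑≤-distrib-+ n f g))
        (ℤ-interchange (∑≤ n f) (∑≤ n g) (f (suc n)) (g (suc n)))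

∑≤-distribʳ-* : ∀ n (f : ℕ → ℤ) c → ∑≤ n (λ k → f k ℤ.* c) ≡ ∑≤ n f ℤ.* c
∑≤-distribʳ-* zero    f c = refl
∑≤-distribʳ-* (suc n) f c =
  trans (cong (ℤ._+ f (suc n) ℤ.* c) (∑≤-distribʳ-* n f c))
        (sym (ℤ.*-distribʳ-+ c (∑≤ n f) (f (suc n))))

∑≤-convolution-point : ∀ n (h : ℕ → ℕ → ℤ) → (∀ k m → h k (suc m) ≡ + 0) →
  ∑≤ n (λ k → h k (n ∸ k)) ≡ h n 0
∑≤-convolution-point zero    h h-sparse = refl
∑≤-convolution-point (suc n) h h-sparse =
  trans (cong₂ ℤ._+_ (∑≤-zero n λ k k≤n →
                        trans (cong (h k) (ℕ.+-∸-assoc 1 k≤n)) (h-sparse k (n ∸ k)))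
                     (cong (h (suc n)) (ℕ.n∸n≡0 n)))
        (ℤ.+-identityˡ _)

∑≤-convolution-shift : ∀ n (h : ℕ → ℕ → ℤ) → (∀ k → h k 0 ≡ + 0) →
  ∑≤ (suc n) (λ k → h k (suc n ∸ k)) ≡ ∑≤ n (λ k → h k (suc (n ∸ k)))
∑≤-convolution-shift n h h-zero =
  trans (cong₂ ℤ._+_ (∑≤-cong n λ k k≤n → cong (h k) (ℕ.+-∸-assoc 1 k≤n))
                     (trans (cong (h (suc n)) (ℕ.n∸n≡0 n)) (h-zero (suc n))))
        (ℤ.+-identityʳ _)

infixr 8 z·_ x·_ q·_
z·_ x·_ q·_ : PS → PS
(z· f) zero    i j = + 0
(z· f) (suc n) i j = f n i j
(x· f) n zero    j = + 0
(x· f) n (suc i) j = f n i j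
(q· f) n i zero    = + 0
(q· f) n i (suc j) = f n i j

shift : ℕ → ℕ → ℕ → PS → PS
shift (suc a) b       d       f = z· shift a b d f
shift zero    (suc b) d       f = x· shift zero b d f
shift zero    zero    (suc d) f = q· shift zero zero d f
shift zero    zero    zero    f = f

constant : ℤ → PS
constant c (suc n) i       j       = + 0
constant c zero    (suc i) j       = + 0
constant c zero    zero    (suc j) = + 0
constant c zero    zero    zero    = c

infixl 7 _⋆_
_⋆_ : PS → ℤ → PS
(f ⋆ c) n i j = f n i j ℤ.* c

shift-cong : ∀ a b d {f g} → f ≐ g → shift a b d f ≐ shift a b d g
shift-cong (suc a) b       d       f≐g zero    i       j       = refl
shift-cong (suc a) b       d       f≐g (suc n) i       j       = shift-cong a b d f≐g n i j
shift-cong zero    (suc b) d       f≐g n       zero    j       = refl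
shift-cong zero    (suc b) d       f≐g n       (suc i) j       = shift-cong zero b d f≐g n i j
shift-cong zero    zero    (suc d) f≐g n       i       zero    = refl
shift-cong zero    zero    (suc d) f≐g n       i       (suc j) = shift-cong zero zero d f≐g n i j
shift-cong zero    zero    zero    f≐g n       i       j       = f≐g n i j

shift-⋆ : ∀ a b d f c → shift a b d (f ⋆ c) ≐ shift a b d f ⋆ c
shift-⋆ (suc a) b       d       f c zero    i       j       = refl
shift-⋆ (suc a) b       d       f c (suc n) i       j       = shift-⋆ a b d f c n i j
shift-⋆ zero    (suc b) d       f c n       zero    j       = refl
shift-⋆ zero    (suc b) d       f c n       (suc i) j       = shift-⋆ zero b d f c n i j
shift-⋆ zero    zero    (suc d) f c n       i       zero    = refl
shift-⋆ zero    zero    (suc d) f c n       i       (suc j) = shift-⋆ zero zero d f c n i j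
shift-⋆ zero    zero    zero    f c n       i       j       = refl

-- `mono` tests its exponents with `⌊ _ ≟ _ ⌋`, which is stuck on variables; `isYes≗does` turns
-- these tests into `_≡ᵇ_`, which computes on `suc`.
mono-shift : ∀ c a b d → mono c a b d ≐ shift a b d (constant c)
mono-shift c a b d n i j
  rewrite isYes≗does (n ℕ.≟ a) | isYes≗does (i ℕ.≟ b) | isYes≗does (j ℕ.≟ d) =
  tests-shift a b d n i j
  where
  tests-shift : ∀ a b d n i j →
    (if (n ℕ.≡ᵇ a) ∧ (i ℕ.≡ᵇ b) ∧ (j ℕ.≡ᵇ d) then c else + 0) ≡ shift a b d (constant c) n i j
  tests-shift (suc a) b       d       zero    i       j       = refl
  tests-shift (suc a) b       d       (suc n) i       j       = tests-shift a b d n i j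
  tests-shift zero    (suc b) d       zero    zero    j       = refl
  tests-shift zero    (suc b) d       (suc n) zero    j       = refl
  tests-shift zero    (suc b) d       n       (suc i) j       = tests-shift zero b d n i j
  tests-shift zero    zero    (suc d) zero    zero    zero    = refl
  tests-shift zero    zero    (suc d) zero    (suc i) zero    = refl
  tests-shift zero    zero    (suc d) (suc n) i       zero    = refl
  tests-shift zero    zero    (suc d) n       i       (suc j) = tests-shift zero zero d n i j
  tests-shift zero    zero    zero    (suc n) i       j       = refl
  tests-shift zero    zero    zero    zero    (suc i) j       = refl
  tests-shift zero    zero    zero    zero    zero    (suc j) = refl
  tests-shift zero    zero    zero    zero    zero    zero    = refl

⊛-congˡ : ∀ {f f′} g → f ≐ f′ → f ⊛ g ≐ f′ ⊛ g
⊛-congˡ g f≐f′ n i j =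
  ∑≤-cong′ n λ n₁ → ∑≤-cong′ i λ i₁ → ∑≤-cong′ j λ j₁ →
    cong (ℤ._* g (n ∸ n₁) (i ∸ i₁) (j ∸ j₁)) (f≐f′ n₁ i₁ j₁)

⊛-congʳ : ∀ f {g g′} → g ≐ g′ → f ⊛ g ≐ f ⊛ g′
⊛-congʳ f g≐g′ n i j =
  ∑≤-cong′ n λ n₁ → ∑≤-cong′ i λ i₁ → ∑≤-cong′ j λ j₁ →
    cong (f n₁ i₁ j₁ ℤ.*_) (g≐g′ (n ∸ n₁) (i ∸ i₁) (j ∸ j₁))

⊛-distribˡ-⊕ : ∀ f g h → f ⊛ (g ⊕ h) ≐ f ⊛ g ⊕ f ⊛ h
⊛-distribˡ-⊕ f g h n i j =
  trans (∑≤-cong′ n λ n₁ →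
           trans (∑≤-cong′ i λ i₁ →
                    trans (∑≤-cong′ j λ j₁ → ℤ.*-distribˡ-+ (f n₁ i₁ j₁) _ _)
                          (∑≤-distrib-+ j _ _))
                 (∑≤-distrib-+ i _ _))
        (∑≤-distrib-+ n _ _)

⊛-⋆ : ∀ f g c → f ⊛ (g ⋆ c) ≐ (f ⊛ g) ⋆ c
⊛-⋆ f g c n i j =
  trans (∑≤-cong′ n λ n₁ →
           trans (∑≤-cong′ i λ i₁ →
                    trans (∑≤-cong′ j λ j₁ → sym (ℤ.*-assoc (f n₁ i₁ j₁) _ c))
                          (∑≤-distribʳ-* j _ c))
                 (∑≤-distribʳ-* i _ c))
        (∑≤-distribʳ-* n _ c)

⊛-z· : ∀ f g → f ⊛ z· g ≐ z· (f ⊛ g)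
⊛-z· f g zero    i j = ∑≤-zero i λ i₁ _ → ∑≤-zero j λ j₁ _ → ℤ.*-zeroʳ (f 0 i₁ j₁)
⊛-z· f g (suc n) i j =
  ∑≤-convolution-shift n
    (λ n₁ m → ∑≤ i λ i₁ → ∑≤ j λ j₁ → f n₁ i₁ j₁ ℤ.* (z· g) m (i ∸ i₁) (j ∸ j₁))
    λ n₁ → ∑≤-zero i λ i₁ _ → ∑≤-zero j λ j₁ _ → ℤ.*-zeroʳ (f n₁ i₁ j₁)

⊛-x· : ∀ f g → f ⊛ x· g ≐ x· (f ⊛ g)
⊛-x· f g n zero    j = ∑≤-zero n λ n₁ _ → ∑≤-zero j λ j₁ _ → ℤ.*-zeroʳ (f n₁ 0 j₁)
⊛-x· f g n (suc i) j =
  ∑≤-cong′ n λ n₁ →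
    ∑≤-convolution-shift i
      (λ i₁ m → ∑≤ j λ j₁ → f n₁ i₁ j₁ ℤ.* (x· g) (n ∸ n₁) m (j ∸ j₁))
      λ i₁ → ∑≤-zero j λ j₁ _ → ℤ.*-zeroʳ (f n₁ i₁ j₁)

⊛-q· : ∀ f g → f ⊛ q· g ≐ q· (f ⊛ g)
⊛-q· f g n i zero    = ∑≤-zero n λ n₁ _ → ∑≤-zero i λ i₁ _ → ℤ.*-zeroʳ (f n₁ i₁ 0)
⊛-q· f g n i (suc j) =
  ∑≤-cong′ n λ n₁ → ∑≤-cong′ i λ i₁ →
    ∑≤-convolution-shift j (λ j₁ m → f n₁ i₁ j₁ ℤ.* (q· g) (n ∸ n₁) (i ∸ i₁) m)
      λ j₁ → ℤ.*-zeroʳ (f n₁ i₁ j₁)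

⊛-shift : ∀ a b d f g → f ⊛ shift a b d g ≐ shift a b d (f ⊛ g)
⊛-shift (suc a) b       d       f g n i j =
  trans (⊛-z· f _ n i j) (shift-cong 1 0 0 (⊛-shift a b d f g) n i j)
⊛-shift zero    (suc b) d       f g n i j =
  trans (⊛-x· f _ n i j) (shift-cong 0 1 0 (⊛-shift zero b d f g) n i j)
⊛-shift zero    zero    (suc d) f g n i j =
  trans (⊛-q· f _ n i j) (shift-cong 0 0 1 (⊛-shift zero zero d f g) n i j)
⊛-shift zero    zero    zero    f g n i j = refl

⊛-constant : ∀ f c → f ⊛ constant c ≐ f ⋆ c
⊛-constant f c n i j =
  trans (∑≤-cong′ n λ n₁ →
           trans (∑≤-cong′ i λ i₁ →
                    ∑≤-convolution-point j
                      (λ j₁ m → f n₁ i₁ j₁ ℤ.* constant c (n ∸ n₁) (i ∸ i₁) m)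
                      λ j₁ m → *-zero-at (f n₁ i₁ j₁) (sparseᵠ (n ∸ n₁) (i ∸ i₁) m))
                 (∑≤-convolution-point i (λ i₁ m → f n₁ i₁ j ℤ.* constant c (n ∸ n₁) m 0)
                    λ i₁ m → *-zero-at (f n₁ i₁ j) (sparseˣ (n ∸ n₁) m)))
        (∑≤-convolution-point n (λ n₁ m → f n₁ i j ℤ.* constant c m 0 0)
           λ n₁ m → ℤ.*-zeroʳ (f n₁ i j))
  where
  *-zero-at : ∀ a {b} → b ≡ + 0 → a ℤ.* b ≡ + 0
  *-zero-at a refl = ℤ.*-zeroʳ a
  sparseᵠ : ∀ n i j → constant c n i (suc j) ≡ + 0
  sparseᵠ zero    zero    j = refl
  sparseᵠ zero    (suc i) j = refl
  sparseᵠ (suc n) i       j = refl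
  sparseˣ : ∀ n i → constant c n (suc i) 0 ≡ + 0
  sparseˣ zero    i = refl
  sparseˣ (suc n) i = refl

infixl 6 _⊕ₚ_
data Polynomial : PS → Set where
  term  : ∀ c a b d → Polynomial (mono c a b d)
  _⊕ₚ_ : ∀ {g h} → Polynomial g → Polynomial h → Polynomial (g ⊕ h)

infixl 7 _⊛ₚ_
_⊛ₚ_ : ∀ {h} → PS → Polynomial h → PS
f ⊛ₚ term c a b d = shift a b d f ⋆ c
f ⊛ₚ (p ⊕ₚ p′)   = f ⊛ₚ p ⊕ f ⊛ₚ p′

⊛-polynomial : ∀ f {h} (p : Polynomial h) → f ⊛ h ≐ f ⊛ₚ p
⊛-polynomial f (term c a b d) n i j = begin
  (f ⊛ mono c a b d) n i j                  ≡⟨ ⊛-congʳ f (mono-shift c a b d) n i j ⟩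
  (f ⊛ shift a b d (constant c)) n i j      ≡⟨ ⊛-shift a b d f (constant c) n i j ⟩
  shift a b d (f ⊛ constant c) n i j        ≡⟨ shift-cong a b d (⊛-constant f c) n i j ⟩
  shift a b d (f ⋆ c) n i j                 ≡⟨ shift-⋆ a b d f c n i j ⟩
  (shift a b d f ⋆ c) n i j                 ∎
  where open ≡-Reasoning
⊛-polynomial f (_⊕ₚ_ {g} {h} p p′) n i j =
  trans (⊛-distribˡ-⊕ f g h n i j) (cong₂ ℤ._+_ (⊛-polynomial f p n i j) (⊛-polynomial f p′ n i j))

⊛-⊛ₚ : ∀ f g {h} (p : Polynomial h) → f ⊛ (g ⊛ₚ p) ≐ (f ⊛ g) ⊛ₚ p
⊛-⊛ₚ f g (term c a b d) n i j =
  trans (⊛-⋆ f (shift a b d g) c n i j) (cong (ℤ._* c) (⊛-shift a b d f g n i j))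
⊛-⊛ₚ f g (p ⊕ₚ p′) n i j =
  trans (⊛-distribˡ-⊕ f (g ⊛ₚ p) (g ⊛ₚ p′) n i j)
        (cong₂ ℤ._+_ (⊛-⊛ₚ f g p n i j) (⊛-⊛ₚ f g p′ n i j))

⊛-assoc-polynomial : ∀ f g {h} → Polynomial h → f ⊛ (g ⊛ h) ≐ (f ⊛ g) ⊛ h
⊛-assoc-polynomial f g {h} p n i j = begin
  (f ⊛ (g ⊛ h)) n i j  ≡⟨ ⊛-congʳ f (⊛-polynomial g p) n i j ⟩
  (f ⊛ (g ⊛ₚ p)) n i j ≡⟨ ⊛-⊛ₚ f g p n i j ⟩
  ((f ⊛ g) ⊛ₚ p) n i j ≡⟨ ⊛-polynomial (f ⊛ g) p n i j ⟨
  ((f ⊛ g) ⊛ h) n i j  ∎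
  where open ≡-Reasoning

-- The generating function

F H : PS
F = genF avoiderCount
H zero    i j = + 0
H (suc n) i j = + wordPoly 1 n i j

F-recurrence : ∀ n i j → F (suc n) i j ≡ (q· H) n i j ℤ.+ (x· F) n i j
F-recurrence zero    zero    zero    = refl
F-recurrence zero    zero    (suc j) = refl
F-recurrence zero    (suc i) zero    = refl
F-recurrence zero    (suc i) (suc j) = refl
F-recurrence (suc n) zero    zero    = refl
F-recurrence (suc n) zero    (suc j) = refl
F-recurrence (suc n) (suc i) zero    = refl
F-recurrence (suc n) (suc i) (suc j) = refl

H-recurrence : ∀ m i j →
  H (3 + m) i j ≡ (q· H) (1 + m) i j ℤ.+ (q· H) (1 + m) i j ℤ.+ H (2 + m) i j
H-recurrence m i zero    = refl
H-recurrence m i (suc j) =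
  cong (λ t → + (t ℕ.+ wordPoly 1 (suc m) i (suc j))) (wordPoly-double 0 m i j)

den₁-polynomial : Polynomial den₁
den₁-polynomial = term (+ 1) 0 0 0 ⊕ₚ term (- + 1) 1 1 0

den₂-polynomial : Polynomial den₂
den₂-polynomial = term (+ 1) 0 0 0 ⊕ₚ term (- + 1) 1 0 0 ⊕ₚ term (- + 2) 2 0 1

-- (1 - x z) F, where z q H counts the avoiders that begin with their maximum.
F₁ : PS
F₁ = constant (+ 1) ⊕ shift 1 0 1 H

F⊛den₁ : F ⊛ den₁ ≐ F₁
F⊛den₁ n i j = trans (⊛-polynomial F den₁-polynomial n i j) (coefficient n i j)
  where
  coefficient : ∀ n i j → (F ⊛ₚ den₁-polynomial) n i j ≡ F₁ n i j
  coefficient zero    zero    zero    = refl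
  coefficient zero    zero    (suc j) = refl
  coefficient zero    (suc i) j       = refl
  coefficient (suc n) i       j       = cancel ((q· H) n i j) ((x· F) n i j) (F-recurrence n i j)
    where
    ring : ∀ a b → (a ℤ.+ b) ℤ.* + 1 ℤ.+ b ℤ.* - + 1 ≡ + 0 ℤ.+ a
    ring = solve-∀
    cancel : ∀ a b {c} → c ≡ a ℤ.+ b → c ℤ.* + 1 ℤ.+ b ℤ.* - + 1 ≡ + 0 ℤ.+ a
    cancel a b refl = ring a b

F₁⊛den₂ : F₁ ⊛ den₂ ≐ numer
F₁⊛den₂ n i j = trans (⊛-polynomial F₁ den₂-polynomial n i j) (coefficient n i j)
  where
  coefficient : ∀ n i j → (F₁ ⊛ₚ den₂-polynomial) n i j ≡ numer n i j
  coefficient 0 0       0             = refl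
  coefficient 0 0       (suc j)       = refl
  coefficient 0 (suc i) j             = refl
  coefficient 1 0       0             = refl
  coefficient 1 0       (suc j)       = refl
  coefficient 1 (suc i) 0             = refl
  coefficient 1 (suc i) (suc j)       = refl
  coefficient 2 0       0             = refl
  coefficient 2 0       1             = refl
  coefficient 2 0       (suc (suc j)) = refl
  coefficient 2 (suc i) 0             = refl
  coefficient 2 (suc i) (suc j)       = refl
  coefficient 3 0       0             = refl
  coefficient 3 0       1             = refl
  coefficient 3 0       (suc (suc j)) = refl
  coefficient 3 1       0             = refl
  coefficient 3 1       1             = refl
  coefficient 3 1       (suc (suc j)) = refl
  coefficient 3 (suc (suc i)) 0             = refl
  coefficient 3 (suc (suc i)) 1             = refl
  coefficient 3 (suc (suc i)) (suc (suc j)) = refl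
  coefficient (suc (suc (suc (suc m)))) i zero    = refl
  coefficient (suc (suc (suc (suc m)))) i (suc j) =
    cancel ((q· H) (suc m) i j) (H (2 + m) i j) (H-recurrence m i j)
    where
    ring : ∀ a b →
      (+ 0 ℤ.+ (a ℤ.+ a ℤ.+ b)) ℤ.* + 1 ℤ.+ (+ 0 ℤ.+ b) ℤ.* - + 1 ℤ.+ (+ 0 ℤ.+ a) ℤ.* - + 2 ≡ + 0
    ring = solve-∀
    cancel : ∀ a b {c} → c ≡ a ℤ.+ a ℤ.+ b →
      (+ 0 ℤ.+ c) ℤ.* + 1 ℤ.+ (+ 0 ℤ.+ b) ℤ.* - + 1 ℤ.+ (+ 0 ℤ.+ a) ℤ.* - + 2 ≡ + 0
    cancel a b refl = ring a b

avoiderCount-hasGF : HasGF avoiderCount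
avoiderCount-hasGF n i j = begin
  (F ⊛ (den₁ ⊛ den₂)) n i j  ≡⟨ ⊛-assoc-polynomial F den₁ den₂-polynomial n i j ⟩
  ((F ⊛ den₁) ⊛ den₂) n i j  ≡⟨ ⊛-congˡ den₂ F⊛den₁ n i j ⟩
  (F₁ ⊛ den₂) n i j          ≡⟨ F₁⊛den₂ n i j ⟩
  numer n i j                ∎
  where open ≡-Reasoning

HasGF-resp : ∀ {c c′} → (∀ n i j → c n i j ≡ c′ n i j) → HasGF c′ → HasGF c
HasGF-resp c≗c′ gf n i j =
  trans (⊛-congˡ (den₁ ⊛ den₂) (λ n i j → cong +_ (c≗c′ n i j)) n i j) (gf n i j)

proposition4p8 : ((c : ℕ → ℕ → ℕ → ℕ) → IsCount (p132 ∷ p231 ∷ []) c → HasGF c)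
               × ((c : ℕ → ℕ → ℕ → ℕ) → IsCount (p213 ∷ p231 ∷ []) c → HasGF c)
proposition4p8 = hasGF MaxFirstOrLast.encoding , hasGF MaxOrMinFirst.encoding
  where
  hasGF : ∀ {ps} → WordEncoding ps → (c : ℕ → ℕ → ℕ → ℕ) → IsCount ps c → HasGF c
  hasGF E c count = HasGF-resp (avoiders-counted E count) avoiderCount-hasGF
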